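{- Let $U$ be a finite set and $\mu$ a closure operator on $2^U$. Direct determination $\dot\rightarrow$ is reflexive, projective and transitive: (i) $X\dot\rightarrow X$ for every $X\subseteq U$; (ii) if $Y\subseteq X\subseteq U$ and $X\mu=Y\mu$ then $X\dot\rightarrow Y$; (iii) if $X\dot\rightarrow Y$ and $Y\dot\rightarrow Z$ then $X\dot\rightarrow Z$.
   Context: A closure operator on $2^U$ is a map $\mu:2^U\to2^U$, $X\mapsto X\mu$, with $X\subseteq X\mu$, $X\subseteq Y\Rightarrow X\mu\subseteq Y\mu$, $X\mu\mu=X\mu$; $\mu$ is identified with the set of pairs $\{(S,S\mu):S\subseteq U\}$. Extension by closure: for a function $\alpha$ (a set of pairs $(S,T)$ of subsets of $U$, at most one pair per $S$) and $X\subseteq U$, put $X\alpha_0=X$, $X\alpha_{t+1}=X\alpha_t\cup\bigcup\{T:(S,T)\in\alpha,\ S\subseteq X\alpha_t\}$; the sequence stabilizes and $X\alpha^+$ is its final value. For a closed set $C$, $\mu_{\subset C}=\{(S,S\mu): S\subseteq U,\ S\mu\subsetneq C\}$. For $X,Y\subseteq U$, $X$ directly determines $Y$, written $X\dot\rightarrow Y$, if $X\mu=Y\mu=C$ and $Y\subseteq X(\mu_{\subset C})^+$. -}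

module Defs where

open import Data.Nat using (ℕ; zero; suc)
open import Data.Fin using (Fin)
open import Data.Fin.Subset using (Subset; _⊆_; _∈_)
open import Data.Product using (Σ; _×_; ∃)
open import Relation.Binary.PropositionalEquality using (_≡_; _≢_)

-- U = Fin n (a finite set); subsets of U are  Subset n.

record IsClosure (n : ℕ) (μ : Subset n → Subset n) : Set where
  field
    extensive  : ∀ X → X ⊆ μ X
    monotone   : ∀ {X Y} → X ⊆ Y → μ X ⊆ μ Y
    idempotent : ∀ X → μ (μ X) ≡ μ X

-- A set of pairs (S , T) of subsets of U, given as a relation.
PairSet : ℕ → Set₁
PairSet n = Subset n → Subset n → Set

data Stage {n : ℕ} (α : PairSet n) (X : Subset n) : ℕ → Fin n → Set where
  base : ∀ {y} → y ∈ X → Stage α X zero y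
  keep : ∀ {t y} → Stage α X t y → Stage α X (suc t) y
  add  : ∀ {t y} (S T : Subset n) → α S T
       → (∀ {z} → z ∈ S → Stage α X t z)
       → y ∈ T → Stage α X (suc t) y

-- y ∈ X α^+ : the sequence X α_t is increasing and stabilises, so its final
-- value is the union of all stages.
_∈Ext_,_ : {n : ℕ} → Fin n → Subset n → PairSet n → Set
y ∈Ext X , α = ∃ λ t → Stage α X t y

μ⊂ : {n : ℕ} → (Subset n → Subset n) → Subset n → PairSet n
μ⊂ μ C S T = T ≡ μ S × T ⊆ C × T ≢ C

DirDet : {n : ℕ} → (Subset n → Subset n) → Subset n → Subset n → Set
DirDet μ X Y = Σ (μ X ≡ μ Y) λ _ →
  ∀ {y} → y ∈ Y → y ∈Ext X , μ⊂ μ (μ X)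

{-# OPTIONS --safe #-}
module Submission where

-- Reflexivity and projectivity hold already at stage 0 of the extension. For
-- transitivity, Xμ = Yμ = Zμ = C, so both determinations extend by the same
-- function μ_{⊂C}; and extension by closure is itself a closure operator, so
-- Y ⊆ Xα⁺ forces Yα⁺ ⊆ Xα⁺.

open import Defs
open import Data.Empty using (⊥-elim)
open import Data.Nat using (ℕ; zero; suc; _≤_; _≤′_; ≤′-refl; ≤′-step; _⊔_)
open import Data.Nat.Properties using (≤⇒≤′; m≤m⊔n; m≤n⊔m)
open import Data.Fin using (Fin)
import Data.Fin as Fin
open import Data.Fin.Subset using (Subset; _⊆_; _∈_)
open import Data.Fin.Subset.Properties using (_∈?_)
open import Data.Product using (_×_; _,_; ∃)
open import Relation.Nullary using (yes; no)
open import Relation.Binary.PropositionalEquality using (_≡_; refl; sym; trans; subst)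

Monotone : {m : ℕ} → (Fin m → ℕ → Set) → Set
Monotone P = ∀ {i t t′} → t ≤ t′ → P i t → P i t′

common-bound : ∀ {m} (P : Fin m → ℕ → Set) → Monotone P →
  (∀ i → ∃ (P i)) → ∃ λ T → ∀ i → P i T
common-bound {zero}  P mono h = 0 , λ ()
common-bound {suc m} P mono h with h Fin.zero | common-bound (λ i → P (Fin.suc i)) mono (λ i → h (Fin.suc i))
... | t₀ , p₀ | T , p = t₀ ⊔ T , λ where
  Fin.zero    → mono (m≤m⊔n t₀ T) p₀
  (Fin.suc i) → mono (m≤n⊔m t₀ T) (p i)

module _ {n : ℕ} {α : PairSet n} {X : Subset n} where

  Stage-mono′ : ∀ {t t′ y} → t ≤′ t′ → Stage α X t y → Stage α X t′ y
  Stage-mono′ ≤′-refl     s = s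
  Stage-mono′ (≤′-step p) s = keep (Stage-mono′ p s)

  Stage-mono : ∀ {t t′ y} → t ≤ t′ → Stage α X t y → Stage α X t′ y
  Stage-mono p = Stage-mono′ (≤⇒≤′ p)

  common-stage : (S : Subset n) → (∀ {z} → z ∈ S → z ∈Ext X , α) →
    ∃ λ t → ∀ {z} → z ∈ S → Stage α X t z
  common-stage S h =
    let t , p = common-bound (λ z t → z ∈ S → Stage α X t z) mono witness
    in t , λ {z} → p z
    where
    mono : Monotone (λ z t → z ∈ S → Stage α X t z)
    mono t≤t′ p z∈S = Stage-mono t≤t′ (p z∈S)

    witness : ∀ z → ∃ λ t → z ∈ S → Stage α X t z
    witness z with z ∈? S
    ... | yes z∈S = let t , s = h z∈S in t , λ _ → s
    ... | no  z∉S = 0 , λ z∈S → ⊥-elim (z∉S z∈S)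

_⊆Ext_,_ : {n : ℕ} → Subset n → Subset n → PairSet n → Set
Y ⊆Ext X , α = ∀ {y} → y ∈ Y → y ∈Ext X , α

Stage⇒∈Ext : ∀ {n} {α : PairSet n} {X Y : Subset n} →
  Y ⊆Ext X , α → ∀ {t z} → Stage α Y t z → z ∈Ext X , α
Stage⇒∈Ext Y⊆X⁺ (base z∈Y) = Y⊆X⁺ z∈Y
Stage⇒∈Ext Y⊆X⁺ (keep s)   = Stage⇒∈Ext Y⊆X⁺ s
Stage⇒∈Ext Y⊆X⁺ (add S T a S⊆Y⁺ z∈T)
  with common-stage S (λ z∈S → Stage⇒∈Ext Y⊆X⁺ (S⊆Y⁺ z∈S))
... | t , S⊆Xₜ = suc t , add S T a S⊆Xₜ z∈T

⊆Ext-trans : ∀ {n} {α : PairSet n} {X Y Z : Subset n} →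
  Y ⊆Ext X , α → Z ⊆Ext Y , α → Z ⊆Ext X , α
⊆Ext-trans Y⊆X⁺ Z⊆Y⁺ z∈Z with Z⊆Y⁺ z∈Z
... | _ , s = Stage⇒∈Ext Y⊆X⁺ s

module _ {n : ℕ} (μ : Subset n → Subset n) where

  DirDet-projective : (X Y : Subset n) → Y ⊆ X → μ X ≡ μ Y → DirDet μ X Y
  DirDet-projective X Y Y⊆X eq = eq , λ y∈Y → 0 , base (Y⊆X y∈Y)

  DirDet-refl : (X : Subset n) → DirDet μ X X
  DirDet-refl X = DirDet-projective X X (λ x∈X → x∈X) refl

  DirDet-trans : (X Y Z : Subset n) → DirDet μ X Y → DirDet μ Y Z → DirDet μ X Z
  DirDet-trans X Y Z (Xμ≡Yμ , Y⊆X⁺) (Yμ≡Zμ , Z⊆Y⁺) =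
    trans Xμ≡Yμ Yμ≡Zμ , ⊆Ext-trans Y⊆X⁺ Z⊆Y⁺′
    where
    Z⊆Y⁺′ : Z ⊆Ext Y , μ⊂ μ (μ X)
    Z⊆Y⁺′ = subst (λ C → Z ⊆Ext Y , μ⊂ μ C) (sym Xμ≡Yμ) Z⊆Y⁺

mainTheorem14 : (n : ℕ) (μ : Subset n → Subset n) → IsClosure n μ →
    ((X : Subset n) → DirDet μ X X)
    × ((X Y : Subset n) → Y ⊆ X → μ X ≡ μ Y → DirDet μ X Y)
    × ((X Y Z : Subset n) → DirDet μ X Y → DirDet μ Y Z → DirDet μ X Z)
mainTheorem14 n μ _ = DirDet-refl μ , DirDet-projective μ , DirDet-trans μ
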